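{- In any model $\langle V,\in\rangle$ of set theory (e.g. of ZFC), the membership relation $\in$ is not definable in the structure $\langle V,\subseteq\rangle$, even allowing parameters from $V$ in the definition. Here $\subseteq$ is the inclusion relation $x\subseteq y\iff\forall z\,(z\in x\to z\in y)$ computed in the model. -}

module Defs where

open import Level using (Level; _⊔_; Lift)
open import Data.Nat using (ℕ; suc)
open import Data.Fin using (Fin)
open import Data.Empty using (⊥)
open import Data.Product using (Σ; ∃; _×_; _,_)
open import Data.Sum using (_⊎_)
open import Data.Vec.Functional using (Vector; _∷_)
open import Relation.Binary.PropositionalEquality using (_≡_)
open import Relation.Nullary using (¬_)

-- First-order formulas in the language of one binary relation symbol
-- (plus equality), with n free variables (de Bruijn indices in Fin n).
data Formula (n : ℕ) : Set where
  rel  : Fin n → Fin n → Formula n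
  eq   : Fin n → Fin n → Formula n
  fls  : Formula n
  _⇒_  : Formula n → Formula n → Formula n
  _∧_  : Formula n → Formula n → Formula n
  _∨_  : Formula n → Formula n → Formula n
  all  : Formula (suc n) → Formula n         -- binds variable 0
  ex   : Formula (suc n) → Formula n

Sat : ∀ {a r} {A : Set a} (R : A → A → Set r) {n : ℕ} →
      Formula n → Vector A n → Set (a ⊔ r)
Sat {a} {r} R (rel i j) ρ = Lift a (R (ρ i) (ρ j))
Sat {a} {r} R (eq i j)  ρ = Lift r (ρ i ≡ ρ j)
Sat {a} {r} R fls       ρ = Lift (a ⊔ r) ⊥
Sat R (φ ⇒ ψ) ρ = Sat R φ ρ → Sat R ψ ρ
Sat R (φ ∧ ψ) ρ = Sat R φ ρ × Sat R ψ ρ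
Sat R (φ ∨ ψ) ρ = Sat R φ ρ ⊎ Sat R ψ ρ
Sat {A = A} R (all φ) ρ = (x : A) → Sat R φ (x ∷ ρ)
Sat {A = A} R (ex φ)  ρ = Σ A λ x → Sat R φ (x ∷ ρ)

_↔_ : ∀ {a b} → Set a → Set b → Set (a ⊔ b)
P ↔ Q = (P → Q) × (Q → P)

-- The finitely many axioms are stated directly;
-- the schemes (Separation, Replacement) range over all first-order formulas
-- in the language {∈} with arbitrary parameters ps, interpreted by Sat.
record ZFCModel {a ℓ} (V : Set a) (_∈_ : V → V → Set ℓ) : Set (a ⊔ ℓ) where
  field
    extensionality : ∀ x y → (∀ z → (z ∈ x) ↔ (z ∈ y)) → x ≡ y
    foundation     : ∀ x → (∃ λ y → y ∈ x) →
                     ∃ λ y → y ∈ x × ¬ (∃ λ z → z ∈ y × z ∈ x)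
    pairing        : ∀ x y → ∃ λ p → x ∈ p × y ∈ p
    union          : ∀ F → ∃ λ U → ∀ Y x → x ∈ Y → Y ∈ F → x ∈ U
    powerset       : ∀ x → ∃ λ P → ∀ z → (∀ w → w ∈ z → w ∈ x) → z ∈ P
    infinity       : ∃ λ I → (∃ λ e → e ∈ I × (∀ w → ¬ (w ∈ e))) ×
                     (∀ y → y ∈ I → ∃ λ s → s ∈ I ×
                        (∀ w → (w ∈ s) ↔ (w ∈ y ⊎ w ≡ y)))
    separation     : ∀ {n} (φ : Formula (suc n)) (ps : Vector V n) x →
                     ∃ λ y → ∀ z → (z ∈ y) ↔ (z ∈ x × Sat _∈_ φ (z ∷ ps))
    replacement    : ∀ {n} (φ : Formula (suc (suc n))) (ps : Vector V n) A →
                     (∀ x → x ∈ A → ∃ λ y → Sat _∈_ φ (x ∷ y ∷ ps) ×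
                        (∀ y' → Sat _∈_ φ (x ∷ y' ∷ ps) → y' ≡ y)) →
                     ∃ λ B → ∀ x → x ∈ A → ∃ λ y → y ∈ B × Sat _∈_ φ (x ∷ y ∷ ps)
    choice         : ∀ X → (∀ A → A ∈ X → ∃ λ u → u ∈ A) →
                     (∀ A B → A ∈ X → B ∈ X → ¬ (A ≡ B) →
                        ¬ (∃ λ z → z ∈ A × z ∈ B)) →
                     ∃ λ C → ∀ A → A ∈ X → ∃ λ c → (c ∈ A × c ∈ C) ×
                        (∀ c' → c' ∈ A × c' ∈ C → c' ≡ c)

Subset : ∀ {a ℓ} {V : Set a} → (V → V → Set ℓ) → V → V → Set (a ⊔ ℓ)
Subset _∈_ x y = ∀ z → z ∈ x → z ∈ y

DefinableWithParams : ∀ {a r s} {A : Set a} (R : A → A → Set r)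
                      (S : A → A → Set s) → Set (a ⊔ r ⊔ s)
DefinableWithParams {A = A} R S =
  Σ ℕ λ n → Σ (Formula (suc (suc n))) λ φ → Σ (Vector A n) λ ps →
    ∀ x y → S x y ↔ Sat R φ (x ∷ y ∷ ps)

-- Satisfaction is invariant under automorphisms, so a relation definable
-- with parameters ps is preserved by every automorphism fixing ps.  For
-- distinct sets u, v, the map σ that exchanges u and v inside every set
-- (without touching the sets u, v themselves) is an automorphism of ⟨V, ⊆⟩,
-- and it fixes every set containing neither u nor v.  Choose, by Russell's
-- paradox, u outside u and all parameters, a set y ∋ u, and v outside u, y
-- and all parameters.  Then σ fixes u and every parameter, u ∈ y, yet u ∉ σ y.

module Submission where

open import Defs
open import Level using (_⊔_; Lift; lift; lower)
open import Axiom.ExcludedMiddle using (ExcludedMiddle)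
open import Relation.Nullary using (¬_; Dec; yes; no)
open import Relation.Nullary.Decidable using (map′)
open import Data.Nat using (zero; suc)
open import Data.Fin using (zero; suc; #_)
open import Data.Empty using (⊥-elim)
open import Data.Product using (∃; _×_; _,_; proj₁; proj₂)
open import Data.Sum using (_⊎_; inj₁; inj₂)
open import Function using (_∘′_)
open import Data.Vec.Functional using (Vector; _∷_; []; head; tail)
open import Relation.Binary.PropositionalEquality
  using (_≡_; refl; sym; trans; cong; subst; subst₂)

module _ {a r} {A : Set a} (R : A → A → Set r) (σ σ⁻¹ : A → A)
  (σ∘σ⁻¹ : ∀ y → σ (σ⁻¹ y) ≡ y) (σ⁻¹∘σ : ∀ x → σ⁻¹ (σ x) ≡ x)
  (σ-preserves : ∀ {x y} → R x y → R (σ x) (σ y))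
  (σ-reflects : ∀ {x y} → R (σ x) (σ y) → R x y) where

  private
    ∷-image : ∀ {n} {ρ ρ' : Vector A n} → (∀ i → ρ' i ≡ σ (ρ i)) →
              ∀ {x y} → y ≡ σ x → ∀ i → (y ∷ ρ') i ≡ σ ((x ∷ ρ) i)
    ∷-image e y≡σx zero    = y≡σx
    ∷-image e y≡σx (suc i) = e i

    σ-injective : ∀ {x y} → σ x ≡ σ y → x ≡ y
    σ-injective {x} {y} σx≡σy =
      trans (sym (σ⁻¹∘σ x)) (trans (cong σ⁻¹ σx≡σy) (σ⁻¹∘σ y))

  Sat-automorphism : ∀ {n} (φ : Formula n) {ρ ρ' : Vector A n} →
                     (∀ i → ρ' i ≡ σ (ρ i)) → Sat R φ ρ ↔ Sat R φ ρ'
  Sat-automorphism (rel i j) e =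
    (λ (lift p) → lift (subst₂ R (sym (e i)) (sym (e j)) (σ-preserves p))) ,
    (λ (lift p) → lift (σ-reflects (subst₂ R (e i) (e j) p)))
  Sat-automorphism (eq i j) e =
    (λ (lift p) → lift (trans (e i) (trans (cong σ p) (sym (e j))))) ,
    (λ (lift p) → lift (σ-injective (trans (sym (e i)) (trans p (e j)))))
  Sat-automorphism fls e = (λ ()) , (λ ())
  Sat-automorphism (φ ⇒ ψ) e =
    let (φ→ , φ←) = Sat-automorphism φ e ; (ψ→ , ψ←) = Sat-automorphism ψ e
    in (λ f → ψ→ ∘′ f ∘′ φ←) , (λ f → ψ← ∘′ f ∘′ φ→)
  Sat-automorphism (φ ∧ ψ) e =
    let (φ→ , φ←) = Sat-automorphism φ e ; (ψ→ , ψ←) = Sat-automorphism ψ e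
    in (λ (p , q) → φ→ p , ψ→ q) , (λ (p , q) → φ← p , ψ← q)
  Sat-automorphism (φ ∨ ψ) e =
    let (φ→ , φ←) = Sat-automorphism φ e ; (ψ→ , ψ←) = Sat-automorphism ψ e
    in (λ { (inj₁ p) → inj₁ (φ→ p) ; (inj₂ q) → inj₂ (ψ→ q) }) ,
       (λ { (inj₁ p) → inj₁ (φ← p) ; (inj₂ q) → inj₂ (ψ← q) })
  Sat-automorphism (all φ) e =
    (λ h y → proj₁ (Sat-automorphism φ (∷-image e (sym (σ∘σ⁻¹ y)))) (h (σ⁻¹ y))) ,
    (λ h x → proj₂ (Sat-automorphism φ (∷-image e refl)) (h (σ x)))
  Sat-automorphism (ex φ) e =
    (λ (x , s) → σ x , proj₁ (Sat-automorphism φ (∷-image e refl)) s) ,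
    (λ (y , s) → σ⁻¹ y , proj₂ (Sat-automorphism φ (∷-image e (sym (σ∘σ⁻¹ y)))) s)

module ZFC {a ℓ} {V : Set a} {_∈_ : V → V → Set ℓ} (M : ZFCModel V _∈_) where
  open ZFCModel M

  _⊆_ : V → V → Set (a ⊔ ℓ)
  _⊆_ = Subset _∈_

  upper-bound₂ : ∀ x y → ∃ λ U → x ⊆ U × y ⊆ U
  upper-bound₂ x y =
    let (p , x∈p , y∈p) = pairing x y ; (U , ⋃p) = union p
    in U , (λ z z∈x → ⋃p x z z∈x x∈p) , (λ z z∈y → ⋃p y z z∈y y∈p)

  upper-bound : ∀ {n} (ps : Vector V n) → ∃ λ U → ∀ i → ps i ⊆ U
  upper-bound {zero}  ps = proj₁ infinity , λ ()
  upper-bound {suc n} ps =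
    let (U , tail⊆U) = upper-bound (tail ps) ; (U' , head⊆U' , U⊆U') = upper-bound₂ (head ps) U
    in U' , λ { zero → head⊆U' ; (suc i) z z∈psi → U⊆U' z (tail⊆U i z z∈psi) }

  russell : ∀ W → ∃ λ r → ¬ r ∈ r × ¬ r ∈ W
  russell W with separation (rel (# 0) (# 0) ⇒ fls) [] W
  ... | r , r∈R↔ = r , r∉r , λ r∈W → r∉r (proj₂ (r∈R↔ r) (r∈W , λ (lift r∈r) → lift (r∉r r∈r)))
    where
    r∉r : ¬ r ∈ r
    r∉r r∈r = lower (proj₂ (proj₁ (r∈R↔ r) r∈r) (lift r∈r))

  fresh : ∀ {n} (ps : Vector V n) → ∃ λ w → ¬ w ∈ w × ∀ i → ¬ w ∈ ps i
  fresh ps =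
    let (U , ps⊆U) = upper-bound ps ; (w , w∉w , w∉U) = russell U
    in w , w∉w , λ i w∈psi → w∉U (ps⊆U i w w∈psi)

  module Swap (em : ExcludedMiddle (a ⊔ ℓ)) (u v : V) (u≢v : ¬ u ≡ v) where

    -- Membership in σ x, as a condition on z; the variables are z, x, u, v.
    swapFormula : Formula 4
    swapFormula =
      (rel (# 0) (# 1) ∧ ((eq (# 0) (# 2) ⇒ fls) ∧ (eq (# 0) (# 3) ⇒ fls))) ∨
      ((eq (# 0) (# 2) ∧ rel (# 3) (# 1)) ∨ (eq (# 0) (# 3) ∧ rel (# 2) (# 1)))

    SwapMember : V → V → Set (a ⊔ ℓ)
    SwapMember x z = (z ∈ x × ¬ z ≡ u × ¬ z ≡ v) ⊎ ((z ≡ u × v ∈ x) ⊎ (z ≡ v × u ∈ x))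

    private
      _≟_ : (x y : V) → Dec (x ≡ y)
      x ≟ y = map′ lower lift (em {Lift ℓ (x ≡ y)})

      bound : V → V
      bound x = proj₁ (upper-bound₂ x (proj₁ (pairing u v)))

      swapSet : ∀ x → ∃ λ y → ∀ z → (z ∈ y) ↔ (z ∈ bound x × Sat _∈_ swapFormula (z ∷ x ∷ u ∷ v ∷ []))
      swapSet x = separation swapFormula (x ∷ u ∷ v ∷ []) (bound x)

    σ : V → V
    σ x = proj₁ (swapSet x)

    ∈σ⇒SwapMember : ∀ {x z} → z ∈ σ x → SwapMember x z
    ∈σ⇒SwapMember {x} {z} z∈σx with proj₂ (proj₁ (proj₂ (swapSet x) z) z∈σx)
    ... | inj₁ (lift p , z≢u , z≢v) =
      inj₁ (p , (λ q → lower (z≢u (lift q))) , (λ q → lower (z≢v (lift q))))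
    ... | inj₂ (inj₁ (lift p , lift q)) = inj₂ (inj₁ (p , q))
    ... | inj₂ (inj₂ (lift p , lift q)) = inj₂ (inj₂ (p , q))

    SwapMember⇒∈σ : ∀ {x z} → SwapMember x z → z ∈ σ x
    SwapMember⇒∈σ {x} {z} m = proj₂ (proj₂ (swapSet x) z) (inBound m , satisfies m)
      where
      x⊆bound : x ⊆ bound x
      x⊆bound = proj₁ (proj₂ (upper-bound₂ x (proj₁ (pairing u v))))
      uv⊆bound : proj₁ (pairing u v) ⊆ bound x
      uv⊆bound = proj₂ (proj₂ (upper-bound₂ x (proj₁ (pairing u v))))
      inBound : SwapMember x z → z ∈ bound x
      inBound (inj₁ (z∈x , _)) = x⊆bound z z∈x
      inBound (inj₂ (inj₁ (refl , _))) = uv⊆bound z (proj₁ (proj₂ (pairing u v)))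
      inBound (inj₂ (inj₂ (refl , _))) = uv⊆bound z (proj₂ (proj₂ (pairing u v)))
      satisfies : SwapMember x z → Sat _∈_ swapFormula (z ∷ x ∷ u ∷ v ∷ [])
      satisfies (inj₁ (p , z≢u , z≢v)) =
        inj₁ (lift p , (λ q → lift (z≢u (lower q))) , (λ q → lift (z≢v (lower q))))
      satisfies (inj₂ (inj₁ (p , q))) = inj₂ (inj₁ (lift p , lift q))
      satisfies (inj₂ (inj₂ (p , q))) = inj₂ (inj₂ (lift p , lift q))

    σ-involutive : ∀ x → σ (σ x) ≡ x
    σ-involutive x = extensionality _ _ λ z → σσx⊆x z , x⊆σσx z
      where
      σσx⊆x : σ (σ x) ⊆ x
      σσx⊆x z z∈σσx with ∈σ⇒SwapMember z∈σσx
      ... | inj₁ (z∈σx , z≢u , z≢v) with ∈σ⇒SwapMember z∈σx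
      ...   | inj₁ (z∈x , _)          = z∈x
      ...   | inj₂ (inj₁ (z≡u , _))   = ⊥-elim (z≢u z≡u)
      ...   | inj₂ (inj₂ (z≡v , _))   = ⊥-elim (z≢v z≡v)
      σσx⊆x z _ | inj₂ (inj₁ (refl , v∈σx)) with ∈σ⇒SwapMember v∈σx
      ...   | inj₁ (_ , _ , v≢v)      = ⊥-elim (v≢v refl)
      ...   | inj₂ (inj₁ (v≡u , _))   = ⊥-elim (u≢v (sym v≡u))
      ...   | inj₂ (inj₂ (_ , u∈x))   = u∈x
      σσx⊆x z _ | inj₂ (inj₂ (refl , u∈σx)) with ∈σ⇒SwapMember u∈σx
      ...   | inj₁ (_ , u≢u , _)      = ⊥-elim (u≢u refl)
      ...   | inj₂ (inj₁ (_ , v∈x))   = v∈x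
      ...   | inj₂ (inj₂ (u≡v , _))   = ⊥-elim (u≢v u≡v)

      x⊆σσx : x ⊆ σ (σ x)
      x⊆σσx z z∈x with z ≟ u | z ≟ v
      ... | yes refl | _ =
        SwapMember⇒∈σ (inj₂ (inj₁ (refl , SwapMember⇒∈σ (inj₂ (inj₂ (refl , z∈x))))))
      ... | no _ | yes refl =
        SwapMember⇒∈σ (inj₂ (inj₂ (refl , SwapMember⇒∈σ (inj₂ (inj₁ (refl , z∈x))))))
      ... | no z≢u | no z≢v =
        SwapMember⇒∈σ (inj₁ (SwapMember⇒∈σ (inj₁ (z∈x , z≢u , z≢v)) , z≢u , z≢v))

    σ-mono : ∀ {x y} → x ⊆ y → σ x ⊆ σ y
    σ-mono x⊆y z z∈σx with ∈σ⇒SwapMember z∈σx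
    ... | inj₁ (z∈x , z≢u , z≢v)  = SwapMember⇒∈σ (inj₁ (x⊆y z z∈x , z≢u , z≢v))
    ... | inj₂ (inj₁ (z≡u , v∈x)) = SwapMember⇒∈σ (inj₂ (inj₁ (z≡u , x⊆y v v∈x)))
    ... | inj₂ (inj₂ (z≡v , u∈x)) = SwapMember⇒∈σ (inj₂ (inj₂ (z≡v , x⊆y u u∈x)))

    σ-reflects-⊆ : ∀ {x y} → σ x ⊆ σ y → x ⊆ y
    σ-reflects-⊆ {x} {y} σx⊆σy = subst₂ _⊆_ (σ-involutive x) (σ-involutive y) (σ-mono σx⊆σy)

    σ-fixes : ∀ {p} → ¬ u ∈ p → ¬ v ∈ p → σ p ≡ p
    σ-fixes {p} u∉p v∉p = extensionality _ _ λ z → σp⊆p z , p⊆σp z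
      where
      σp⊆p : σ p ⊆ p
      σp⊆p z z∈σp with ∈σ⇒SwapMember z∈σp
      ... | inj₁ (z∈p , _)        = z∈p
      ... | inj₂ (inj₁ (_ , v∈p)) = ⊥-elim (v∉p v∈p)
      ... | inj₂ (inj₂ (_ , u∈p)) = ⊥-elim (u∉p u∈p)
      p⊆σp : p ⊆ σ p
      p⊆σp z z∈p = SwapMember⇒∈σ (inj₁ (z∈p , (λ { refl → u∉p z∈p }) , (λ { refl → v∉p z∈p })))

    u∉σ : ∀ {y} → ¬ v ∈ y → ¬ u ∈ σ y
    u∉σ v∉y u∈σy with ∈σ⇒SwapMember u∈σy
    ... | inj₁ (_ , u≢u , _)      = u≢u refl
    ... | inj₂ (inj₁ (_ , v∈y))   = v∉y v∈y
    ... | inj₂ (inj₂ (u≡v , _))   = u≢v u≡v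

    Sat-swap : ∀ {n} (φ : Formula n) {ρ ρ' : Vector V n} →
               (∀ i → ρ' i ≡ σ (ρ i)) → Sat _⊆_ φ ρ ↔ Sat _⊆_ φ ρ'
    Sat-swap = Sat-automorphism _⊆_ σ σ σ-involutive σ-involutive σ-mono σ-reflects-⊆

corollary1p4 : ∀ {a ℓ} → ExcludedMiddle (a ⊔ ℓ) →
    (V : Set a) (_∈_ : V → V → Set ℓ) → ZFCModel V _∈_ →
    ¬ DefinableWithParams (Subset _∈_) _∈_
corollary1p4 em V _∈_ M (n , φ , ps , defines) = u∉σ v∉y u∈σy
  where
  open ZFC M
  open ZFCModel M using (pairing)
  u y v : V
  u = proj₁ (fresh ps)
  y = proj₁ (pairing u u)
  v = proj₁ (fresh (u ∷ y ∷ ps))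
  u∈y : u ∈ y
  u∈y = proj₁ (proj₂ (pairing u u))
  v∉ : ∀ i → ¬ v ∈ (u ∷ y ∷ ps) i
  v∉ = proj₂ (proj₂ (fresh (u ∷ y ∷ ps)))
  v∉y : ¬ v ∈ y
  v∉y = v∉ (# 1)
  open Swap em u v (λ u≡v → v∉y (subst (_∈ y) u≡v u∈y))
  σ-fixes-u-ps : ∀ i → (u ∷ σ y ∷ ps) i ≡ σ ((u ∷ y ∷ ps) i)
  σ-fixes-u-ps zero          = sym (σ-fixes (proj₁ (proj₂ (fresh ps))) (v∉ zero))
  σ-fixes-u-ps (suc zero)    = refl
  σ-fixes-u-ps (suc (suc i)) = sym (σ-fixes (proj₂ (proj₂ (fresh ps)) i) (v∉ (suc (suc i))))
  u∈σy : u ∈ σ y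
  u∈σy = proj₂ (defines u (σ y))
           (proj₁ (Sat-swap φ σ-fixes-u-ps) (proj₁ (defines u y) u∈y))
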